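{- Let $F$ be a CNF formula in which no two clauses resolve. Then a clause $c \in F$ is superredundant in $F$ if and only if $F$ contains a clause that is a strict subset of $c$.
   Context: A CNF formula is a finite set of clauses; a clause is a finite set of literals, read as their disjunction. Tautological clauses are not allowed. Resolution: from clauses $c_1 \vee l$ and $c_2 \vee \neg l$ derive $c_1 \vee c_2$; two clauses resolve if they can be written in this form with the resolvent not a tautology (clauses whose resolvent would be a tautology are considered not to resolve). The resolution closure $\mathrm{ResCn}(F)$ is the set of all clauses obtainable from $F$ by zero or more resolution steps. A clause $c \in F$ is superredundant in $F$ if $\mathrm{ResCn}(F) \setminus \{c\} \models c$. -}

module Defs where

open import Data.Nat using (ℕ)
open import Data.Bool using (Bool; true; false; not)
open import Data.List using (List)
open import Data.List.Membership.Propositional using (_∈_)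
open import Data.Product using (_×_; ∃; ∃-syntax; Σ-syntax)
open import Data.Sum using (_⊎_)
open import Relation.Nullary using (¬_)
open import Relation.Binary.PropositionalEquality using (_≡_; _≢_)

data Literal : Set where
  pos : ℕ → Literal
  neg : ℕ → Literal

∼_ : Literal → Literal
∼ pos x = neg x
∼ neg x = pos x

-- A clause is a finite set of literals, represented by a list; only
-- membership matters (all notions below are invariant under reordering
-- and duplication).
Clause : Set
Clause = List Literal

CNF : Set
CNF = List Clause

Tautology : Clause → Set
Tautology c = ∃[ l ] (l ∈ c × (∼ l) ∈ c)

_⊆_ : Clause → Clause → Set
c ⊆ d = ∀ {l} → l ∈ c → l ∈ d

_≈_ : Clause → Clause → Set
c ≈ d = (c ⊆ d) × (d ⊆ c)

_⊂_ : Clause → Clause → Set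
c ⊂ d = (c ⊆ d) × ¬ (d ⊆ c)

Resolvent : Clause → Clause → Literal → Clause → Set
Resolvent d₁ d₂ l r =
  (l ∈ d₁) × ((∼ l) ∈ d₂) ×
  (∀ x → x ∈ r → ((x ∈ d₁ × x ≢ l) ⊎ (x ∈ d₂ × x ≢ ∼ l))) ×
  (∀ x → ((x ∈ d₁ × x ≢ l) ⊎ (x ∈ d₂ × x ≢ ∼ l)) → x ∈ r) ×
  ¬ Tautology r

Resolve : Clause → Clause → Set
Resolve d₁ d₂ = ∃[ l ] ∃[ r ] Resolvent d₁ d₂ l r

NoTwoResolve : CNF → Set
NoTwoResolve F = ∀ {d₁ d₂} → d₁ ∈ F → d₂ ∈ F → ¬ Resolve d₁ d₂

data ResCn (F : CNF) : Clause → Set where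
  base : ∀ {d} → d ∈ F → ResCn F d
  step : ∀ {d₁ d₂ l r} → ResCn F d₁ → ResCn F d₂ → Resolvent d₁ d₂ l r → ResCn F r

Assignment : Set
Assignment = ℕ → Bool

LitTrue : Assignment → Literal → Set
LitTrue α (pos x) = α x ≡ true
LitTrue α (neg x) = α x ≡ false

Sat : Assignment → Clause → Set
Sat α c = ∃[ l ] (l ∈ c × LitTrue α l)

_⊨_ : (Clause → Set) → Clause → Set
S ⊨ c = ∀ (α : Assignment) → (∀ d → S d → Sat α d) → Sat α c

Superredundant : CNF → Clause → Set
Superredundant F c = (λ d → ResCn F d × ¬ (d ≈ c)) ⊨ c

-- Since no two clauses of F resolve, ResCn(F) = F, so if F has no strict
-- subclause of c it suffices to falsify c while satisfying every clause of F
-- not contained in c. For non-tautological clauses, "no two clauses resolve"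
-- means that two clashing clauses always clash on a second variable. This
-- survives restricting the formula by the partial assignment falsifying c,
-- and a formula of non-empty clauses with this property is satisfiable:
-- fix its variables one at a time, noting that the unit clauses {x} and {¬x}
-- cannot both occur, since they would clash on x alone.
module Submission where

open import Defs
open import Data.List.Membership.Propositional using (_∈_)
open import Data.List.Relation.Unary.All using (All)
open import Data.Product using (_×_; ∃-syntax)
open import Relation.Nullary using (¬_)
open import Function.Bundles using (_⇔_)

open import Data.Bool using (Bool; true; false; if_then_else_)
open import Data.Nat using (ℕ; _≟_)
open import Data.List using (List; []; _∷_; [_]; map; filter; concatMap; _++_)
open import Data.List.Relation.Unary.Any using (Any; here; there; any?)
import Data.List.Relation.Unary.All as All
open import Data.List.Relation.Unary.All.Properties using (¬All⇒Any¬)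
open import Data.List.Membership.Propositional using (_∉_; find; lose)
open import Data.List.Membership.Propositional.Properties
  using (∈-filter⁺; ∈-filter⁻; ∈-map⁺; ∈-map⁻; ∈-++⁺ˡ; ∈-++⁺ʳ; ∈-++⁻; ∈-concat⁺′)
open import Data.List.Relation.Binary.Subset.Propositional.Properties using (filter-⊆)
open import Data.Product using (_,_; proj₁; proj₂)
open import Data.Sum using (_⊎_; inj₁; inj₂)
open import Data.Empty using (⊥-elim)
open import Function using (_∘_)
open import Function.Bundles using (mk⇔)
open import Relation.Nullary using (Dec; yes; no; ¬?; does; contradiction)
open import Relation.Nullary.Decidable using (map′; _×-dec_; decidable-stable; dec-true; dec-false)
open import Relation.Binary.Definitions using (DecidableEquality)
open import Relation.Binary.PropositionalEquality using (_≡_; _≢_; refl; sym; trans; cong; subst)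

var : Literal → ℕ
var (pos x) = x
var (neg x) = x

sign : Literal → Bool
sign (pos _) = true
sign (neg _) = false

infix 4 _≟ₗ_
_≟ₗ_ : DecidableEquality Literal
pos x ≟ₗ pos y = map′ (cong pos) (λ { refl → refl }) (x ≟ y)
pos _ ≟ₗ neg _ = no λ ()
neg _ ≟ₗ pos _ = no λ ()
neg x ≟ₗ neg y = map′ (cong neg) (λ { refl → refl }) (x ≟ y)

open import Data.List.Membership.DecPropositional _≟ₗ_ using (_∈?_; _∉?_)
open import Data.List.Relation.Binary.Subset.DecPropositional _≟ₗ_ using (_⊆?_)

∼-involutive : ∀ l → ∼ (∼ l) ≡ l
∼-involutive (pos _) = refl
∼-involutive (neg _) = refl

∼l≢l : ∀ l → ∼ l ≢ l
∼l≢l (pos _) ()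
∼l≢l (neg _) ()

var-∼ : ∀ l → var (∼ l) ≡ var l
var-∼ (pos _) = refl
var-∼ (neg _) = refl

≡-var⇒≡⊎≡∼ : ∀ m l → var m ≡ var l → m ≡ l ⊎ m ≡ ∼ l
≡-var⇒≡⊎≡∼ (pos x) (pos .x) refl = inj₁ refl
≡-var⇒≡⊎≡∼ (pos x) (neg .x) refl = inj₂ refl
≡-var⇒≡⊎≡∼ (neg x) (pos .x) refl = inj₂ refl
≡-var⇒≡⊎≡∼ (neg x) (neg .x) refl = inj₁ refl

nonTautology⇒var-injective : ∀ {d l m} → ¬ Tautology d → l ∈ d → m ∈ d → var m ≡ var l → m ≡ l
nonTautology⇒var-injective {l = l} {m} nt l∈ m∈ e with ≡-var⇒≡⊎≡∼ m l e
... | inj₁ m≡l = m≡l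
... | inj₂ refl = ⊥-elim (nt (l , l∈ , m∈))

nonTautology-⊆ : ∀ {c d} → c ⊆ d → ¬ Tautology d → ¬ Tautology c
nonTautology-⊆ c⊆d nt (l , l∈ , ∼l∈) = nt (l , c⊆d l∈ , c⊆d ∼l∈)

unit-nonTautology : ∀ l → ¬ Tautology [ l ]
unit-nonTautology l (.l , here refl , here ∼l≡l) = ∼l≢l l ∼l≡l

tautology? : ∀ c → Dec (Tautology c)
tautology? c = map′ find (λ (l , l∈ , ∼l∈) → lose l∈ ∼l∈) (any? (λ l → ∼ l ∈? c) c)

⊈⇒∃∉ : ∀ {d c} → ¬ d ⊆ c → ∃[ m ] (m ∈ d × m ∉ c)
⊈⇒∃∉ {d} {c} d⊈c = find (¬All⇒Any¬ (_∈? c) d (d⊈c ∘ All.lookup))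

_⊂?_ : ∀ d c → Dec (d ⊂ c)
d ⊂? c = d ⊆? c ×-dec ¬? (c ⊆? d)

sign⇒LitTrue : ∀ α l → α (var l) ≡ sign l → LitTrue α l
sign⇒LitTrue α (pos _) e = e
sign⇒LitTrue α (neg _) e = e

LitTrue⇒sign : ∀ α l → LitTrue α l → α (var l) ≡ sign l
LitTrue⇒sign α (pos _) e = e
LitTrue⇒sign α (neg _) e = e

¬LitTrue-∼ : ∀ α l → LitTrue α l → ¬ LitTrue α (∼ l)
¬LitTrue-∼ α (pos _) p q with () ← trans (sym p) q
¬LitTrue-∼ α (neg _) p q with () ← trans (sym p) q

Falsifies : Assignment → Clause → Set
Falsifies α c = ∀ {k} → k ∈ c → LitTrue α (∼ k)

Satisfies : Assignment → CNF → Set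
Satisfies α S = ∀ {d} → d ∈ S → Sat α d

setTrue : Literal → Assignment → Assignment
setTrue t α y = if does (y ≟ var t) then sign t else α y

setTrue-true : ∀ t α → LitTrue (setTrue t α) t
setTrue-true t α = sign⇒LitTrue (setTrue t α) t
  (cong (λ b → if b then sign t else α (var t)) (dec-true (var t ≟ var t) refl))

setTrue-preserves : ∀ t α {m} → var m ≢ var t → LitTrue α m → LitTrue (setTrue t α) m
setTrue-preserves t α {m} m≁t m-true = sign⇒LitTrue (setTrue t α) m (trans
  (cong (λ b → if b then sign t else α (var m)) (dec-false (var m ≟ var t) m≁t))
  (LitTrue⇒sign α m m-true))

falsify : Clause → Assignment → Assignment
falsify []      α = α
falsify (k ∷ c) α = setTrue (∼ k) (falsify c α)

falsify-falsifies : ∀ {c} α → ¬ Tautology c → Falsifies (falsify c α) c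
falsify-falsifies {k ∷ c} α nt (here refl) = setTrue-true (∼ k) (falsify c α)
falsify-falsifies {k′ ∷ c} α nt {k} (there k∈) with var (∼ k) ≟ var (∼ k′)
... | no k≁k′ = setTrue-preserves (∼ k′) _ k≁k′ (falsify-falsifies α (nonTautology-⊆ there nt) k∈)
... | yes e with nonTautology⇒var-injective nt (here refl) (there k∈)
                   (trans (sym (var-∼ k)) (trans e (var-∼ k′)))
...   | refl = setTrue-true (∼ k) _

falsify-preserves : ∀ c α {m} → (∀ {k} → k ∈ c → var m ≢ var k) →
  LitTrue α m → LitTrue (falsify c α) m
falsify-preserves []      α apart m-true = m-true
falsify-preserves (k ∷ c) α apart m-true = setTrue-preserves (∼ k) _
  (λ e → apart (here refl) (trans e (var-∼ k)))
  (falsify-preserves c α (apart ∘ there) m-true)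

Clashes : Clause → Clause → Set
Clashes d c = Any (λ k → ∼ k ∈ d) c

clashes? : ∀ d c → Dec (Clashes d c)
clashes? d c = any? (λ k → ∼ k ∈? d) c

strip : Clause → Clause → Clause
strip c = filter (_∉? c)

-- S ↾ c is S under the partial assignment falsifying c: clauses containing
-- the complement of a literal of c are satisfied and dropped, and the
-- literals of c are deleted from the others.
_↾_ : CNF → Clause → CNF
S ↾ c = map (strip c) (filter (λ d → ¬? (clashes? d c)) S)

∈-strip⁺ : ∀ {c d m} → m ∈ d → m ∉ c → m ∈ strip c d
∈-strip⁺ {c} = ∈-filter⁺ (_∉? c)

∈-strip⁻ : ∀ {c d m} → m ∈ strip c d → m ∈ d × m ∉ c
∈-strip⁻ {c} = ∈-filter⁻ (_∉? c)

∈-↾⁺ : ∀ {S c d} → d ∈ S → ¬ Clashes d c → strip c d ∈ S ↾ c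
∈-↾⁺ {c = c} d∈ nc = ∈-map⁺ (strip c) (∈-filter⁺ (λ d → ¬? (clashes? d c)) d∈ nc)

∈-↾⁻ : ∀ {S c d′} → d′ ∈ S ↾ c → ∃[ d ] (d ∈ S × ¬ Clashes d c × d′ ≡ strip c d)
∈-↾⁻ {S} {c} i with ∈-map⁻ (strip c) i
... | d , j , refl =
  let d∈ , nc = ∈-filter⁻ (λ d → ¬? (clashes? d c)) {xs = S} j in d , d∈ , nc , refl

unclashed-apart : ∀ {c d m} → ¬ Clashes d c → m ∈ d → m ∉ c →
  ∀ {k} → k ∈ c → var m ≢ var k
unclashed-apart {m = m} nc m∈d m∉c {k} k∈c e with ≡-var⇒≡⊎≡∼ m k e
... | inj₁ refl = m∉c k∈c
... | inj₂ refl = nc (lose k∈c m∈d)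

↾-satisfies : ∀ {S c} α → ¬ Tautology c → Satisfies α (S ↾ c) → Satisfies (falsify c α) S
↾-satisfies {c = c} α nt α⊨ {d} d∈ with clashes? d c
... | yes cl = let k , k∈c , ∼k∈d = find cl in ∼ k , ∼k∈d , falsify-falsifies α nt k∈c
... | no nc =
  let m , m∈ , m-true = α⊨ (∈-↾⁺ d∈ nc)
      m∈d , m∉c = ∈-strip⁻ {c} m∈
  in m , m∈d , falsify-preserves c α (unclashed-apart nc m∈d m∉c) m-true

↾-nonEmpty : ∀ {S c} → (∀ {d} → d ∈ S → ¬ d ⊆ c) → ∀ {d′} → d′ ∈ S ↾ c → ∃[ m ] m ∈ d′
↾-nonEmpty {c = c} avoid i with ∈-↾⁻ i
... | d , d∈ , _ , refl = let m , m∈ , m∉ = ⊈⇒∃∉ (avoid d∈) in m , ∈-strip⁺ {c} m∈ m∉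

↾-vars : ∀ {S c V} → (∀ {d m} → d ∈ S → m ∈ d → var m ∈ V) →
  ∀ {d′ m} → d′ ∈ S ↾ c → m ∈ d′ → var m ∈ V × (∀ {k} → k ∈ c → var m ≢ var k)
↾-vars {c = c} vars i m∈ with ∈-↾⁻ i
... | d , d∈ , nc , refl =
  let m∈d , m∉c = ∈-strip⁻ {c} m∈ in vars d∈ m∈d , unclashed-apart nc m∈d m∉c

MultiClash : CNF → Set
MultiClash S = ∀ {d₁ d₂} → d₁ ∈ S → d₂ ∈ S → ∀ {l} → l ∈ d₁ → ∼ l ∈ d₂ →
  ∃[ m ] (m ∈ d₁ × ∼ m ∈ d₂ × var m ≢ var l)

multiClash-⊆ : ∀ {S T} → (∀ {d} → d ∈ S → d ∈ T) → MultiClash T → MultiClash S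
multiClash-⊆ S⊆T mc d₁∈ d₂∈ = mc (S⊆T d₁∈) (S⊆T d₂∈)

↾-multiClash : ∀ {S} c → MultiClash S → MultiClash (S ↾ c)
↾-multiClash c mc i₁ i₂ l∈ ∼l∈ with ∈-↾⁻ i₁ | ∈-↾⁻ i₂
... | d₁ , d₁∈ , nc₁ , refl | d₂ , d₂∈ , nc₂ , refl =
  let m , m∈d₁ , ∼m∈d₂ , m≁l = mc d₁∈ d₂∈ (proj₁ (∈-strip⁻ {c} l∈)) (proj₁ (∈-strip⁻ {c} ∼l∈))
      ∼∼m∈d₁ = subst (_∈ d₁) (sym (∼-involutive m)) m∈d₁
  in m , ∈-strip⁺ {c} m∈d₁ (λ m∈c → nc₂ (lose m∈c ∼m∈d₂))
       , ∈-strip⁺ {c} ∼m∈d₂ (λ ∼m∈c → nc₁ (lose ∼m∈c ∼∼m∈d₁)) , m≁l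

unit-falsifiable : ∀ {S} → MultiClash S → (∀ {d} → d ∈ S → ∃[ l ] l ∈ d) →
  ∀ x → ∃[ l ] (var l ≡ x × ∀ {d} → d ∈ S → ¬ d ⊆ [ l ])
unit-falsifiable {S} mc ne x with any? (_⊆? [ neg x ]) S
... | no none = neg x , refl , λ d∈ d⊆ → none (lose d∈ d⊆)
... | yes some with find some
...   | d₀ , d₀∈ , d₀⊆ = pos x , refl , no-unit-pos
  where
  no-unit-pos : ∀ {d} → d ∈ S → ¬ d ⊆ [ pos x ]
  no-unit-pos d∈ d⊆ with ne d₀∈ | ne d∈
  ... | l₀ , l₀∈ | l , l∈ with d₀⊆ l₀∈ | d⊆ l∈
  ... | here refl | here refl with mc d₀∈ d∈ l₀∈ l∈
  ... | m , m∈ , _ , m≁x with d₀⊆ m∈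
  ... | here refl = m≁x refl

satisfiable : ∀ V {S} → MultiClash S → (∀ {d} → d ∈ S → ∃[ l ] l ∈ d) →
  (∀ {d m} → d ∈ S → m ∈ d → var m ∈ V) → ∃[ α ] Satisfies α S
satisfiable [] mc ne vars =
  (λ _ → true) , λ d∈ → let _ , l∈ = ne d∈ in contradiction (vars d∈ l∈) λ ()
satisfiable (x ∷ V) {S} mc ne vars with unit-falsifiable mc ne x
... | l , refl , avoid =
  let α , α⊨ = satisfiable V (↾-multiClash [ l ] mc) (↾-nonEmpty avoid) vars′
  in falsify [ l ] α , ↾-satisfies α (unit-nonTautology l) α⊨
  where
  vars′ : ∀ {d m} → d ∈ S ↾ [ l ] → m ∈ d → var m ∈ V
  vars′ d∈ m∈ with ↾-vars vars d∈ m∈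
  ... | here m≈l , apart = contradiction m≈l (apart (here refl))
  ... | there v  , _     = v

variables : CNF → List ℕ
variables = concatMap (map var)

∈-variables : ∀ {S d m} → d ∈ S → m ∈ d → var m ∈ variables S
∈-variables d∈ m∈ = ∈-concat⁺′ (∈-map⁺ var m∈) (∈-map⁺ (map var) d∈)

falsifiable-satisfiable : ∀ {S c} → MultiClash S → ¬ Tautology c →
  (∀ {d} → d ∈ S → ¬ d ⊆ c) → ∃[ α ] (Falsifies α c × Satisfies α S)
falsifiable-satisfiable {S} {c} mc nt avoid =
  let α , α⊨ = satisfiable (variables (S ↾ c)) (↾-multiClash c mc) (↾-nonEmpty avoid) ∈-variables
  in falsify c α , falsify-falsifies α nt , ↾-satisfies α nt α⊨

resolvent : Clause → Clause → Literal → Clause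
resolvent d₁ d₂ l = filter (λ x → ¬? (x ≟ₗ l)) d₁ ++ filter (λ x → ¬? (x ≟ₗ ∼ l)) d₂

module _ {d₁ d₂ : Clause} {l : Literal} where

  ∈-resolvent⁺ : ∀ x → (x ∈ d₁ × x ≢ l) ⊎ (x ∈ d₂ × x ≢ ∼ l) → x ∈ resolvent d₁ d₂ l
  ∈-resolvent⁺ x (inj₁ (x∈ , x≢)) = ∈-++⁺ˡ (∈-filter⁺ (λ x → ¬? (x ≟ₗ l)) x∈ x≢)
  ∈-resolvent⁺ x (inj₂ (x∈ , x≢)) =
    ∈-++⁺ʳ (filter (λ x → ¬? (x ≟ₗ l)) d₁) (∈-filter⁺ (λ x → ¬? (x ≟ₗ ∼ l)) x∈ x≢)

  ∈-resolvent⁻ : ∀ x → x ∈ resolvent d₁ d₂ l → (x ∈ d₁ × x ≢ l) ⊎ (x ∈ d₂ × x ≢ ∼ l)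
  ∈-resolvent⁻ x x∈ with ∈-++⁻ (filter (λ x → ¬? (x ≟ₗ l)) d₁) x∈
  ... | inj₁ x∈₁ = inj₁ (∈-filter⁻ (λ x → ¬? (x ≟ₗ l)) x∈₁)
  ... | inj₂ x∈₂ = inj₂ (∈-filter⁻ (λ x → ¬? (x ≟ₗ ∼ l)) x∈₂)

  ¬Resolve⇒tautological-resolvent : l ∈ d₁ → ∼ l ∈ d₂ → ¬ Resolve d₁ d₂ →
    Tautology (resolvent d₁ d₂ l)
  ¬Resolve⇒tautological-resolvent l∈ ∼l∈ nr = decidable-stable (tautology? _)
    λ nt → nr (l , _ , l∈ , ∼l∈ , ∈-resolvent⁻ , ∈-resolvent⁺ , nt)

  tautological-resolvent⇒second-clash : ¬ Tautology d₁ → ¬ Tautology d₂ → l ∈ d₁ →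
    Tautology (resolvent d₁ d₂ l) → ∃[ m ] (m ∈ d₁ × ∼ m ∈ d₂ × var m ≢ var l)
  tautological-resolvent⇒second-clash nt₁ nt₂ l∈ (m , m∈ , ∼m∈)
    with ∈-resolvent⁻ m m∈ | ∈-resolvent⁻ (∼ m) ∼m∈
  ... | inj₁ (m∈₁ , _)   | inj₁ (∼m∈₁ , _)   = ⊥-elim (nt₁ (m , m∈₁ , ∼m∈₁))
  ... | inj₂ (m∈₂ , _)   | inj₂ (∼m∈₂ , _)   = ⊥-elim (nt₂ (m , m∈₂ , ∼m∈₂))
  ... | inj₁ (m∈₁ , m≢l) | inj₂ (∼m∈₂ , _)   =
    m , m∈₁ , ∼m∈₂ , m≢l ∘ nonTautology⇒var-injective nt₁ l∈ m∈₁
  ... | inj₂ (m∈₂ , _)   | inj₁ (∼m∈₁ , ∼m≢l) =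
    ∼ m , ∼m∈₁ , subst (_∈ d₂) (sym (∼-involutive m)) m∈₂ ,
    ∼m≢l ∘ nonTautology⇒var-injective nt₁ l∈ ∼m∈₁

noTwoResolve⇒multiClash : ∀ {F} → All (λ d → ¬ Tautology d) F → NoTwoResolve F → MultiClash F
noTwoResolve⇒multiClash nt ntr d₁∈ d₂∈ l∈ ∼l∈ =
  tautological-resolvent⇒second-clash (All.lookup nt d₁∈) (All.lookup nt d₂∈) l∈
    (¬Resolve⇒tautological-resolvent l∈ ∼l∈ (ntr d₁∈ d₂∈))

noTwoResolve⇒ResCn⊆ : ∀ {F d} → NoTwoResolve F → ResCn F d → d ∈ F
noTwoResolve⇒ResCn⊆ ntr (base d∈) = d∈
noTwoResolve⇒ResCn⊆ ntr (step p q res) =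
  ⊥-elim (ntr (noTwoResolve⇒ResCn⊆ ntr p) (noTwoResolve⇒ResCn⊆ ntr q) (_ , _ , res))

strictSubset⇒superredundant : ∀ {F c d} → d ∈ F → d ⊂ c → Superredundant F c
strictSubset⇒superredundant d∈ (d⊆c , c⊈d) α α⊨ =
  let l , l∈ , l-true = α⊨ _ (base d∈ , c⊈d ∘ proj₂) in l , d⊆c l∈ , l-true

¬strictSubset⇒¬superredundant : ∀ {F c} → All (λ d → ¬ Tautology d) F → NoTwoResolve F →
  c ∈ F → (∀ {d} → d ∈ F → ¬ d ⊂ c) → ¬ Superredundant F c
¬strictSubset⇒¬superredundant {F} {c} nt ntr c∈ none sr =
  let α , α⊭c , α⊨S = falsifiable-satisfiable
                         (multiClash-⊆ (filter-⊆ _ F) (noTwoResolve⇒multiClash nt ntr))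
                         (All.lookup nt c∈) (proj₂ ∘ ∈-filter⁻ ⊈c? {xs = F})
      l , l∈c , l-true = sr α λ d (d∈ , d≉c) → α⊨S (ResCn∖c⊆S d∈ d≉c)
  in ¬LitTrue-∼ α l l-true (α⊭c l∈c)
  where
  ⊈c? : ∀ d → Dec (¬ d ⊆ c)
  ⊈c? d = ¬? (d ⊆? c)

  ResCn∖c⊆S : ∀ {d} → ResCn F d → ¬ d ≈ c → d ∈ filter ⊈c? F
  ResCn∖c⊆S rc d≉c = ∈-filter⁺ ⊈c? d∈ λ d⊆c →
    d≉c (d⊆c , decidable-stable (c ⊆? _) λ c⊈d → none d∈ (d⊆c , c⊈d))
    where d∈ = noTwoResolve⇒ResCn⊆ ntr rc

lemma8 : (F : CNF) → All (λ d → ¬ Tautology d) F → NoTwoResolve F →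
    (c : Clause) → c ∈ F →
    Superredundant F c ⇔ (∃[ d ] (d ∈ F × d ⊂ c))
lemma8 F nt ntr c c∈ = mk⇔ superredundant⇒strictSubset
  λ (d , d∈ , d⊂c) → strictSubset⇒superredundant d∈ d⊂c
  where
  superredundant⇒strictSubset : Superredundant F c → ∃[ d ] (d ∈ F × d ⊂ c)
  superredundant⇒strictSubset sr with any? (_⊂? c) F
  ... | yes some = find some
  ... | no none  = contradiction sr
    (¬strictSubset⇒¬superredundant nt ntr c∈ λ d∈ d⊂c → none (lose d∈ d⊂c))
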